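{- Let $X$ be a set of size $n$ and let $\circ$ be a partially defined binary operation on $X$ that is injective in each variable separately and for which there are at least $\epsilon n^3$ triples $(x,y,z)\in X^3$ with $x\circ(y\circ z)=(x\circ y)\circ z$ (all expressions and subexpressions defined). Then the multiplication table of $\circ$ contains at least $\epsilon^4n^5$ octahedra.
   Context: $\circ$ is injective in each variable separately if $x\circ y=x\circ y'$ (both defined) implies $y=y'$, and $x\circ y=x'\circ y$ (both defined) implies $x=x'$. The multiplication table of $\circ$ is the partial Latin square with column set $X$, row set $X$, label set $X$, set of labelled cells $E=\{(x,y): x\circ y \text{ defined}\}$ and labelling $(x,y)\mapsto x\circ y$. In a partial Latin square with labelled cell set $A$ and labelling $\lambda$, an octahedron is a pair of rectangles $((x_1,y_1),(x_2,y_1),(x_1,y_2),(x_2,y_2))\in A^4$ and $((x_3,y_3),(x_4,y_3),(x_3,y_4),(x_4,y_4))\in A^4$ such that $\lambda(x_1,y_1)=\lambda(x_3,y_3)$, $\lambda(x_2,y_1)=\lambda(x_4,y_3)$, $\lambda(x_1,y_2)=\lambda(x_3,y_4)$ and $\lambda(x_2,y_2)=\lambda(x_4,y_4)$; degeneracies are allowed, and octahedra are counted as such ordered tuples $(x_1,x_2,y_1,y_2,x_3,x_4,y_3,y_4)$.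
   Formalization: The density parameter ε ranges only over the nonnegative rationals. -}

module Defs where

open import Data.Nat using (ℕ; zero; suc; _+_; _^_)
open import Data.Fin using (Fin)
open import Data.List using (List; map; allFin)
open import Data.Nat.ListAction using (sum)
open import Data.Maybe using (Maybe; just; nothing; _>>=_)
open import Data.Product using (Σ; ∃; _×_; _,_)
open import Data.Integer using (+_)
open import Data.Rational using (ℚ; _/_)
open import Relation.Binary.PropositionalEquality using (_≡_)
open import Relation.Nullary using (Dec; yes; no)

PartialOp : ℕ → Set
PartialOp n = Fin n → Fin n → Maybe (Fin n)

InjectiveInEachVariable : ∀ {n} → PartialOp n → Set
InjectiveInEachVariable {n} op =
  (∀ (x y y' c : Fin n) → op x y ≡ just c → op x y' ≡ just c → y ≡ y')
  × (∀ (x x' y c : Fin n) → op x y ≡ just c → op x' y ≡ just c → x ≡ x')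

AssocTriple : ∀ {n} → PartialOp n → Fin n → Fin n → Fin n → Set
AssocTriple {n} op x y z =
  Σ (Fin n) λ c → ((op y z >>= op x) ≡ just c)
                × ((op x y >>= λ b → op b z) ≡ just c)

SameLabel : ∀ {n} → PartialOp n → Fin n → Fin n → Fin n → Fin n → Set
SameLabel {n} op x y x' y' = Σ (Fin n) λ c → (op x y ≡ just c) × (op x' y' ≡ just c)

-- (x1,x2,y1,y2,x3,x4,y3,y4) is an octahedron of the multiplication table:
-- the two rectangles lie in the set of labelled cells and have matching labels
Octahedron : ∀ {n} → PartialOp n →
  (x₁ x₂ y₁ y₂ x₃ x₄ y₃ y₄ : Fin n) → Set
Octahedron op x₁ x₂ y₁ y₂ x₃ x₄ y₃ y₄ =
    SameLabel op x₁ y₁ x₃ y₃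
  × SameLabel op x₂ y₁ x₄ y₃
  × SameLabel op x₁ y₂ x₃ y₄
  × SameLabel op x₂ y₂ x₄ y₄

sameLabel? : ∀ {n} (op : PartialOp n) x y x' y' → Dec (SameLabel op x y x' y')
sameLabel? op x y x' y' with op x y | op x' y'
... | nothing | _ = no λ { (c , () , _) }
... | just a | nothing = no λ { (c , _ , ()) }
... | just a | just b with a Data.Fin.≟ b
...   | yes Relation.Binary.PropositionalEquality.refl = yes (a , Relation.Binary.PropositionalEquality.refl , Relation.Binary.PropositionalEquality.refl)
...   | no a≢b = no λ { (c , Relation.Binary.PropositionalEquality.refl , Relation.Binary.PropositionalEquality.refl) → a≢b Relation.Binary.PropositionalEquality.refl }

maybeSame? : ∀ {n} (p q : Maybe (Fin n)) → Dec (Σ (Fin n) λ c → (p ≡ just c) × (q ≡ just c))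
maybeSame? nothing q = no λ { (c , () , _) }
maybeSame? (just a) nothing = no λ { (c , _ , ()) }
maybeSame? (just a) (just b) with a Data.Fin.≟ b
... | yes Relation.Binary.PropositionalEquality.refl = yes (a , Relation.Binary.PropositionalEquality.refl , Relation.Binary.PropositionalEquality.refl)
... | no a≢b = no λ { (c , Relation.Binary.PropositionalEquality.refl , Relation.Binary.PropositionalEquality.refl) → a≢b Relation.Binary.PropositionalEquality.refl }

assocTriple? : ∀ {n} (op : PartialOp n) x y z → Dec (AssocTriple op x y z)
assocTriple? op x y z = maybeSame? (op y z >>= op x) (op x y >>= λ b → op b z)

octahedron? : ∀ {n} (op : PartialOp n) x₁ x₂ y₁ y₂ x₃ x₄ y₃ y₄ →
  Dec (Octahedron op x₁ x₂ y₁ y₂ x₃ x₄ y₃ y₄)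
octahedron? op x₁ x₂ y₁ y₂ x₃ x₄ y₃ y₄ =
  sameLabel? op x₁ y₁ x₃ y₃ ×-dec (sameLabel? op x₂ y₁ x₄ y₃
    ×-dec (sameLabel? op x₁ y₂ x₃ y₄ ×-dec sameLabel? op x₂ y₂ x₄ y₄))
  where open import Relation.Nullary.Decidable using (_×-dec_)

indicator : ∀ {P : Set} → Dec P → ℕ
indicator (yes _) = 1
indicator (no _) = 0

sumFin : ∀ n → (Fin n → ℕ) → ℕ
sumFin n f = sum (map f (allFin n))

#assocTriples : ∀ {n} → PartialOp n → ℕ
#assocTriples {n} op =
  sumFin n λ x → sumFin n λ y → sumFin n λ z → indicator (assocTriple? op x y z)

#octahedra : ∀ {n} → PartialOp n → ℕ
#octahedra {n} op =
  sumFin n λ x₁ → sumFin n λ x₂ → sumFin n λ y₁ → sumFin n λ y₂ →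
  sumFin n λ x₃ → sumFin n λ x₄ → sumFin n λ y₃ → sumFin n λ y₄ →
  indicator (octahedron? op x₁ x₂ y₁ y₂ x₃ x₄ y₃ y₄)

ℕtoℚ : ℕ → ℚ
ℕtoℚ m = + m / 1

-- For a fixed middle element g, the associative triples (a, g, b) form a bipartite
-- graph with e_g edges; applying Cauchy–Schwarz twice, it contains at least e_g⁴ / n⁴
-- rectangles (a, a', b, b'), and by the power-mean inequality Σ_g e_g⁴ ≥ T⁴ / n³, where
-- T = Σ_g e_g ≥ εn³.  A rectangle at g yields the octahedron formed by the rectangles
-- {a∘g, a'∘g} × {b, b'} and {a, a'} × {g∘b, g∘b'}, whose labels agree because
-- (a∘g)∘b = a∘(g∘b) and so on; since a∘g determines g, distinct g give distinct
-- octahedra.  Hence there are at least T⁴ / n⁷ ≥ ε⁴n⁵ octahedra.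

module Submission where

open import Defs

module Counting where

  open import Data.Nat using (ℕ; zero; suc; _+_; _*_; _^_; _≤_; _<_; z≤n)
  open import Data.Nat.Properties hiding (suc-injective; _≟_)
  open import Data.Fin using (Fin; zero; suc; _≟_)
  open import Data.Fin.Properties using (suc-injective)
  open import Data.Bool using (if_then_else_)
  open import Data.Maybe using (just; nothing; fromMaybe)
  open import Data.Product using (_×_; _,_; proj₁)
  open import Data.Sum using (inj₁; inj₂)
  open import Data.List using (tabulate)
  open import Data.List.Properties using (map-tabulate)
  import Data.Nat.ListAction as List
  open import Function using (_∘_; case_of_)
  open import Relation.Nullary using (Dec; yes; no; does; contradiction)
  open import Relation.Nullary.Decidable using (_×-dec_)
  open import Relation.Binary.PropositionalEquality
  open import Data.Nat.Tactic.RingSolver using (solve-∀)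
  open import Algebra.Properties.Semiring.Sum +-*-semiring
    using (sum; sum-syntax; sum-cong-≗; sum-replicate-zero; ∑-comm; ∑-distrib-+; *-distribˡ-sum; *-distribʳ-sum)

  infix 9 _²

  _² : ℕ → ℕ
  m ² = m * m

  ∑-mono-≤ : ∀ {n} {f g : Fin n → ℕ} → (∀ i → f i ≤ g i) → sum f ≤ sum g
  ∑-mono-≤ {zero}  f≤g = z≤n
  ∑-mono-≤ {suc n} f≤g = +-mono-≤ (f≤g zero) (∑-mono-≤ (f≤g ∘ suc))

  ≤-∑ : ∀ {n} (f : Fin n → ℕ) i → f i ≤ sum f
  ≤-∑ f zero    = m≤m+n _ _
  ≤-∑ f (suc i) = ≤-trans (≤-∑ (f ∘ suc) i) (m≤n+m _ _)

  ≤-∑₃ : ∀ {n} (f : Fin n → Fin n → Fin n → ℕ) i j k → f i j k ≤ ∑[ i < n ] ∑[ j < n ] ∑[ k < n ] f i j k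
  ≤-∑₃ f i j k =
    ≤-trans (≤-∑ (f i j) k) (≤-trans (≤-∑ (λ j → sum (f i j)) j) (≤-∑ (λ i → ∑[ j < _ ] sum (f i j)) i))

  ∑-const : ∀ n c → ∑[ i < n ] c ≡ n * c
  ∑-const zero    c = refl
  ∑-const (suc n) c = cong (c +_) (∑-const n c)

  ∑-zero : ∀ {n} {f : Fin n → ℕ} → (∀ i → f i ≡ 0) → sum f ≡ 0
  ∑-zero {n} f≡0 = trans (sum-cong-≗ f≡0) (sum-replicate-zero n)

  sum-*-sum : ∀ {m n} (f : Fin m → ℕ) (g : Fin n → ℕ) →
    sum f * sum g ≡ ∑[ i < m ] ∑[ j < n ] (f i * g j)
  sum-*-sum f g = trans (*-distribʳ-sum (sum g) f) (sum-cong-≗ λ i → *-distribˡ-sum (f i) g)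

  ∑-comm₄ : ∀ {n} (f : Fin n → Fin n → Fin n → Fin n → Fin n → ℕ) →
    ∑[ i < n ] ∑[ a < n ] ∑[ b < n ] ∑[ c < n ] ∑[ d < n ] f i a b c d ≡
    ∑[ a < n ] ∑[ b < n ] ∑[ c < n ] ∑[ d < n ] ∑[ i < n ] f i a b c d
  ∑-comm₄ f =
    trans (∑-comm λ i a → ∑[ b < _ ] ∑[ c < _ ] ∑[ d < _ ] f i a b c d) (sum-cong-≗ λ a →
    trans (∑-comm λ i b → ∑[ c < _ ] ∑[ d < _ ] f i a b c d) (sum-cong-≗ λ b →
    trans (∑-comm λ i c → ∑[ d < _ ] f i a b c d) (sum-cong-≗ λ c →
    ∑-comm λ i d → f i a b c d)))

  m≤n⇒2*m*n≤m²+n² : ∀ {m n} → m ≤ n → 2 * (m * n) ≤ m ² + n ²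
  m≤n⇒2*m*n≤m²+n² {m} m≤n with d , refl ← m≤n⇒∃[o]m+o≡n m≤n =
    subst (2 * (m * (m + d)) ≤_) (square-gap m d) (m≤m+n _ _)
    where
    square-gap : ∀ m d → 2 * (m * (m + d)) + d * d ≡ m * m + (m + d) * (m + d)
    square-gap = solve-∀

  2*m*n≤m²+n² : ∀ m n → 2 * (m * n) ≤ m ² + n ²
  2*m*n≤m²+n² m n with ≤-total m n
  ... | inj₁ m≤n = m≤n⇒2*m*n≤m²+n² m≤n
  ... | inj₂ n≤m = subst₂ _≤_ (cong (2 *_) (*-comm n m)) (+-comm (n ²) (m ²)) (m≤n⇒2*m*n≤m²+n² n≤m)

  cauchy-schwarz : ∀ n (f : Fin n → ℕ) → sum f ² ≤ n * ∑[ i < n ] (f i ²)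
  cauchy-schwarz n f = *-cancelˡ-≤ 2 (begin
    2 * (sum f * sum f)                          ≡⟨ cong (2 *_) (sum-*-sum f f) ⟩
    2 * ∑[ i < n ] ∑[ j < n ] (f i * f j)        ≡⟨ *-distribˡ-sum 2 (λ i → ∑[ j < n ] (f i * f j)) ⟩
    ∑[ i < n ] (2 * ∑[ j < n ] (f i * f j))      ≡⟨ sum-cong-≗ (λ i → *-distribˡ-sum 2 (λ j → f i * f j)) ⟩
    ∑[ i < n ] ∑[ j < n ] (2 * (f i * f j))      ≤⟨ ∑-mono-≤ (λ i → ∑-mono-≤ λ j → 2*m*n≤m²+n² (f i) (f j)) ⟩
    ∑[ i < n ] ∑[ j < n ] (f i ² + f j ²)        ≡⟨ sum-cong-≗ (λ i → ∑-distrib-+ (λ _ → f i ²) (λ j → f j ²)) ⟩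
    ∑[ i < n ] (∑[ j < n ] (f i ²) + Q)          ≡⟨ ∑-distrib-+ (λ i → ∑[ j < n ] (f i ²)) (λ _ → Q) ⟩
    ∑[ i < n ] ∑[ j < n ] (f i ²) + ∑[ i < n ] Q ≡⟨ cong₂ _+_ (sum-cong-≗ λ i → ∑-const n (f i ²)) (∑-const n Q) ⟩
    ∑[ i < n ] (n * f i ²) + n * Q               ≡⟨ cong (_+ n * Q) (*-distribˡ-sum n (λ i → f i ²)) ⟨
    n * Q + n * Q                                ≡⟨ cong (n * Q +_) (+-identityʳ (n * Q)) ⟨
    2 * (n * Q)                                  ∎)
    where
    open ≤-Reasoning
    Q = ∑[ j < n ] (f j ²)

  cauchy-schwarz₂ : ∀ m n (f : Fin m → Fin n → ℕ) →
    (∑[ i < m ] ∑[ j < n ] f i j) ² ≤ m * n * ∑[ i < m ] ∑[ j < n ] (f i j ²)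
  cauchy-schwarz₂ m n f = begin
    (∑[ i < m ] ∑[ j < n ] f i j) ²              ≤⟨ cauchy-schwarz m (λ i → ∑[ j < n ] f i j) ⟩
    m * ∑[ i < m ] ((∑[ j < n ] f i j) ²)        ≤⟨ *-monoʳ-≤ m (∑-mono-≤ λ i → cauchy-schwarz n (f i)) ⟩
    m * ∑[ i < m ] (n * ∑[ j < n ] (f i j ²))    ≡⟨ cong (m *_) (*-distribˡ-sum n (λ i → ∑[ j < n ] (f i j ²))) ⟨
    m * (n * ∑[ i < m ] ∑[ j < n ] (f i j ²))    ≡⟨ *-assoc m n _ ⟨
    m * n * ∑[ i < m ] ∑[ j < n ] (f i j ²)      ∎
    where open ≤-Reasoning

  power-mean₄ : ∀ n (f : Fin n → ℕ) → (sum f ²) ² ≤ n * n * n * ∑[ i < n ] ((f i ²) ²)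
  power-mean₄ n f = begin
    (sum f ²) ²                                  ≤⟨ *-mono-≤ (cauchy-schwarz n f) (cauchy-schwarz n f) ⟩
    (n * Q) * (n * Q)                            ≡⟨ [m*n]*[o*p]≡[m*o]*[n*p] n Q n Q ⟩
    (n * n) * Q ²                                ≤⟨ *-monoʳ-≤ (n * n) (cauchy-schwarz n (λ i → f i ²)) ⟩
    (n * n) * (n * ∑[ i < n ] ((f i ²) ²))       ≡⟨ *-assoc (n * n) n _ ⟨
    n * n * n * ∑[ i < n ] ((f i ²) ²)           ∎
    where
    open ≤-Reasoning
    Q = ∑[ i < n ] (f i ²)

  rectangles : ∀ {m n} → (Fin m → Fin n → ℕ) → ℕ
  rectangles {m} {n} w =
    ∑[ b < n ] ∑[ b' < n ] ∑[ a < m ] ∑[ a' < m ] ((w a b * w a b') * (w a' b * w a' b'))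

  rectangles-bound : ∀ m n (w : Fin m → Fin n → ℕ) →
    ((∑[ a < m ] ∑[ b < n ] w a b) ²) ² ≤ m * m * (n * n) * rectangles w
  rectangles-bound m n w = begin
    (e ²) ²                                                ≤⟨ *-mono-≤ e²≤m*K e²≤m*K ⟩
    (m * K) * (m * K)                                      ≡⟨ [m*n]*[o*p]≡[m*o]*[n*p] m K m K ⟩
    (m * m) * K ²                                          ≤⟨ *-monoʳ-≤ (m * m) (cauchy-schwarz₂ n n codegree) ⟩
    (m * m) * (n * n * ∑[ b < n ] ∑[ b' < n ] (codegree b b' ²))
                                                           ≡⟨ cong (λ r → (m * m) * (n * n * r)) rectangles≡ ⟨
    (m * m) * (n * n * rectangles w)                       ≡⟨ *-assoc (m * m) (n * n) _ ⟨
    m * m * (n * n) * rectangles w                         ∎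
    where
    open ≤-Reasoning
    e = ∑[ a < m ] ∑[ b < n ] w a b
    codegree : Fin n → Fin n → ℕ
    codegree b b' = ∑[ a < m ] (w a b * w a b')
    K = ∑[ b < n ] ∑[ b' < n ] codegree b b'
    K≡∑rowSum² : K ≡ ∑[ a < m ] (sum (w a) ²)
    K≡∑rowSum² =
      trans (sum-cong-≗ λ b → ∑-comm λ b' a → w a b * w a b')
      (trans (∑-comm λ b a → ∑[ b' < n ] (w a b * w a b'))
             (sum-cong-≗ λ a → sym (sum-*-sum (w a) (w a))))
    e²≤m*K : e ² ≤ m * K
    e²≤m*K = subst (e ² ≤_) (cong (m *_) (sym K≡∑rowSum²)) (cauchy-schwarz m (λ a → sum (w a)))
    rectangles≡ : rectangles w ≡ ∑[ b < n ] ∑[ b' < n ] (codegree b b' ²)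
    rectangles≡ = sum-cong-≗ λ b → sum-cong-≗ λ b' →
      sym (sum-*-sum (λ a → w a b * w a b') (λ a → w a b * w a b'))

  ∑-≤-uniqueSupport : ∀ {n} (f : Fin n → ℕ) {B} → (∀ i → f i ≤ B) →
    (∀ i j → 0 < f i → 0 < f j → i ≡ j) → sum f ≤ B
  ∑-≤-uniqueSupport {zero}  f f≤B unique = z≤n
  ∑-≤-uniqueSupport {suc n} f {B} f≤B unique with 0 <? f zero
  ... | no 0≮f0 = begin
    f zero + sum (f ∘ suc)  ≡⟨ cong (_+ sum (f ∘ suc)) (n≤0⇒n≡0 (≮⇒≥ 0≮f0)) ⟩
    sum (f ∘ suc)           ≤⟨ ∑-≤-uniqueSupport (f ∘ suc) (f≤B ∘ suc) (λ i j p q → suc-injective (unique _ _ p q)) ⟩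
    B                       ∎
    where open ≤-Reasoning
  ... | yes 0<f0 = begin
    f zero + sum (f ∘ suc)  ≡⟨ cong (f zero +_) (∑-zero tail≡0) ⟩
    f zero + 0              ≡⟨ +-identityʳ (f zero) ⟩
    f zero                  ≤⟨ f≤B zero ⟩
    B                       ∎
    where
    open ≤-Reasoning
    tail≡0 : ∀ i → f (suc i) ≡ 0
    tail≡0 i = n≤0⇒n≡0 (≮⇒≥ λ 0<fi → case unique zero (suc i) 0<f0 0<fi of λ ())

  ∑-δ : ∀ {n} (y : Fin n) c → ∑[ x < n ] (if does (y ≟ x) then c else 0) ≡ c
  ∑-δ {suc n} zero    c = trans (cong (c +_) (sum-replicate-zero n)) (+-identityʳ c)
  ∑-δ {suc n} (suc y) c = ∑-δ y c

  ∑-≤-alongInjection : ∀ {m n} (f : Fin m → ℕ) (h : Fin n → ℕ) (φ : Fin m → Fin n) →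
    (∀ i → f i ≤ h (φ i)) → (∀ i j → 0 < f i → 0 < f j → φ i ≡ φ j → i ≡ j) →
    sum f ≤ sum h
  ∑-≤-alongInjection {m} {n} f h φ f≤h∘φ injective = begin
    ∑[ i < m ] f i                    ≡⟨ sum-cong-≗ (λ i → ∑-δ (φ i) (f i)) ⟨
    ∑[ i < m ] ∑[ x < n ] fibre x i   ≡⟨ ∑-comm (λ i x → fibre x i) ⟩
    ∑[ x < n ] ∑[ i < m ] fibre x i   ≤⟨ ∑-mono-≤ (λ x → ∑-≤-uniqueSupport (fibre x) (fibre≤h x) (fibre-unique x)) ⟩
    ∑[ x < n ] h x                    ∎
    where
    open ≤-Reasoning
    fibre : Fin n → Fin m → ℕ
    fibre x i = if does (φ i ≟ x) then f i else 0
    fibre≤h : ∀ x i → fibre x i ≤ h x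
    fibre≤h x i with φ i ≟ x
    ... | yes refl = f≤h∘φ i
    ... | no _     = z≤n
    fibre-unique : ∀ x i j → 0 < fibre x i → 0 < fibre x j → i ≡ j
    fibre-unique x i j with φ i ≟ x | φ j ≟ x
    ... | yes φi≡x | yes φj≡x = λ p q → injective i j p q (trans φi≡x (sym φj≡x))
    ... | no _     | _        = λ ()
    ... | yes _    | no _     = λ _ ()

  indicator-* : ∀ {P Q : Set} (p? : Dec P) (q? : Dec Q) →
    indicator p? * indicator q? ≡ indicator (p? ×-dec q?)
  indicator-* (yes _) (yes _) = refl
  indicator-* (yes _) (no _)  = refl
  indicator-* (no _)  _       = refl

  indicator-≤ : ∀ {P : Set} (p? : Dec P) {k} → (P → 1 ≤ k) → indicator p? ≤ k
  indicator-≤ (yes p) 1≤k = 1≤k p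
  indicator-≤ (no _)  _   = z≤n

  indicator-≥ : ∀ {P : Set} (p? : Dec P) → P → 1 ≤ indicator p?
  indicator-≥ (yes _) _ = ≤-refl
  indicator-≥ (no ¬p) p = contradiction p ¬p

  indicator-pos : ∀ {P : Set} (p? : Dec P) → 0 < indicator p? → P
  indicator-pos (yes p) _ = p

  sumFin≡∑ : ∀ n {f g : Fin n → ℕ} → (∀ i → f i ≡ g i) → sumFin n f ≡ sum g
  sumFin≡∑ n {f} f≗g = trans (cong List.sum (map-tabulate (λ i → i) f)) (trans (sum-tabulate n f) (sum-cong-≗ f≗g))
    where
    sum-tabulate : ∀ n (f : Fin n → ℕ) → List.sum (tabulate f) ≡ sum f
    sum-tabulate zero    f = refl
    sum-tabulate (suc n) f = cong (f zero +_) (sum-tabulate n (f ∘ suc))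

  module _ {n} (op : PartialOp n) where

    infixl 7 _∙_

    -- x ∙ y is x ∘ y where that is defined; the junk value y elsewhere is never inspected.
    _∙_ : Fin n → Fin n → Fin n
    x ∙ y = fromMaybe y (op x y)

    assoc⇒leftDefined : ∀ {x y z} → AssocTriple op x y z → op x y ≡ just (x ∙ y)
    assoc⇒leftDefined {x} {y} (_ , _ , e) with op x y
    ... | just _  = refl
    ... | nothing = case e of λ ()

    assoc⇒sameLabel : ∀ {x y z} → AssocTriple op x y z → SameLabel op (x ∙ y) z x (y ∙ z)
    assoc⇒sameLabel {x} {y} {z} (c , e₁ , e₂) with op x y | op y z
    ... | just _  | just _  = c , e₂ , e₁
    ... | nothing | _       = case e₂ of λ ()
    ... | just _  | nothing = case e₁ of λ ()

    RectangleAt : (g a a' b b' : Fin n) → Set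
    RectangleAt g a a' b b' =
      (AssocTriple op a g b × AssocTriple op a g b') × (AssocTriple op a' g b × AssocTriple op a' g b')

    rectangleAt? : ∀ g a a' b b' → Dec (RectangleAt g a a' b b')
    rectangleAt? g a a' b b' =
      (assocTriple? op a g b ×-dec assocTriple? op a g b') ×-dec (assocTriple? op a' g b ×-dec assocTriple? op a' g b')

    rectangle⇒octahedron : ∀ {g a a' b b'} → RectangleAt g a a' b b' →
      Octahedron op (a ∙ g) (a' ∙ g) b b' a a' (g ∙ b) (g ∙ b')
    rectangle⇒octahedron ((t₁ , t₂) , (t₃ , t₄)) =
      assoc⇒sameLabel t₁ , assoc⇒sameLabel t₃ , assoc⇒sameLabel t₂ , assoc⇒sameLabel t₄

    [assoc] : Fin n → Fin n → Fin n → ℕ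
    [assoc] x y z = indicator (assocTriple? op x y z)

    [rectangle] : (g a a' b b' : Fin n) → ℕ
    [rectangle] g a a' b b' = ([assoc] a g b * [assoc] a g b') * ([assoc] a' g b * [assoc] a' g b')

    [oct] : (x₁ x₂ y₁ y₂ x₃ x₄ y₃ y₄ : Fin n) → ℕ
    [oct] x₁ x₂ y₁ y₂ x₃ x₄ y₃ y₄ = indicator (octahedron? op x₁ x₂ y₁ y₂ x₃ x₄ y₃ y₄)

    [rectangle]≡indicator : ∀ g a a' b b' → [rectangle] g a a' b b' ≡ indicator (rectangleAt? g a a' b b')
    [rectangle]≡indicator g a a' b b' =
      trans (cong₂ _*_ (indicator-* (assocTriple? op a g b) (assocTriple? op a g b'))
                       (indicator-* (assocTriple? op a' g b) (assocTriple? op a' g b')))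
            (indicator-* (assocTriple? op a g b ×-dec assocTriple? op a g b')
                         (assocTriple? op a' g b ×-dec assocTriple? op a' g b'))

    #assocTriples≡ : #assocTriples op ≡ ∑[ g < n ] ∑[ a < n ] ∑[ b < n ] [assoc] a g b
    #assocTriples≡ =
      trans (sumFin≡∑ n λ _ → sumFin≡∑ n λ _ → sumFin≡∑ n λ _ → refl)
            (∑-comm λ a g → ∑[ b < n ] [assoc] a g b)

    #octahedra≡ : #octahedra op ≡
      ∑[ x₁ < n ] ∑[ x₂ < n ] ∑[ y₁ < n ] ∑[ y₂ < n ] ∑[ x₃ < n ] ∑[ x₄ < n ] ∑[ y₃ < n ] ∑[ y₄ < n ]
        [oct] x₁ x₂ y₁ y₂ x₃ x₄ y₃ y₄
    #octahedra≡ =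
      sumFin≡∑ n λ _ → sumFin≡∑ n λ _ → sumFin≡∑ n λ _ → sumFin≡∑ n λ _ →
      sumFin≡∑ n λ _ → sumFin≡∑ n λ _ → sumFin≡∑ n λ _ → sumFin≡∑ n λ _ → refl

    module _ (injectiveʳ : ∀ x y y' c → op x y ≡ just c → op x y' ≡ just c → y ≡ y') where

      rectanglesAt-≤-octahedra : ∀ a a' b b' →
        ∑[ g < n ] [rectangle] g a a' b b' ≤
        ∑[ x₁ < n ] ∑[ x₂ < n ] ∑[ y₃ < n ] ∑[ y₄ < n ] [oct] x₁ x₂ b b' a a' y₃ y₄
      rectanglesAt-≤-octahedra a a' b b' = ∑-≤-alongInjection _ _ (a ∙_) bound injective
        where
        rectangle : ∀ {g} → 0 < [rectangle] g a a' b b' → RectangleAt g a a' b b'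
        rectangle {g} pos =
          indicator-pos (rectangleAt? g a a' b b') (≤-trans pos (≤-reflexive ([rectangle]≡indicator g a a' b b')))
        bound : ∀ g → [rectangle] g a a' b b' ≤
                      ∑[ x₂ < n ] ∑[ y₃ < n ] ∑[ y₄ < n ] [oct] (a ∙ g) x₂ b b' a a' y₃ y₄
        bound g = ≤-trans (≤-reflexive ([rectangle]≡indicator g a a' b b'))
          (indicator-≤ (rectangleAt? g a a' b b') λ r →
            ≤-trans (indicator-≥ (octahedron? op _ _ _ _ _ _ _ _) (rectangle⇒octahedron r))
                    (≤-∑₃ (λ x₂ y₃ y₄ → [oct] (a ∙ g) x₂ b b' a a' y₃ y₄) (a' ∙ g) (g ∙ b) (g ∙ b')))
        injective : ∀ g g' → 0 < [rectangle] g a a' b b' → 0 < [rectangle] g' a a' b b' →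
          a ∙ g ≡ a ∙ g' → g ≡ g'
        injective g g' pos pos' a∙g≡a∙g' = injectiveʳ a g g' (a ∙ g)
          (assoc⇒leftDefined (proj₁ (proj₁ (rectangle pos))))
          (trans (assoc⇒leftDefined (proj₁ (proj₁ (rectangle pos')))) (cong just (sym a∙g≡a∙g')))

      ∑rectangles-≤-#octahedra : ∑[ g < n ] rectangles (λ a b → [assoc] a g b) ≤ #octahedra op
      ∑rectangles-≤-#octahedra = begin
        ∑[ g < n ] ∑[ b < n ] ∑[ b' < n ] ∑[ a < n ] ∑[ a' < n ] [rectangle] g a a' b b'
          ≡⟨ ∑-comm₄ (λ g b b' a a' → [rectangle] g a a' b b') ⟩
        ∑[ b < n ] ∑[ b' < n ] ∑[ a < n ] ∑[ a' < n ] ∑[ g < n ] [rectangle] g a a' b b'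
          ≤⟨ ∑-mono-≤ (λ b → ∑-mono-≤ λ b' → ∑-mono-≤ λ a → ∑-mono-≤ λ a' → rectanglesAt-≤-octahedra a a' b b') ⟩
        ∑[ b < n ] ∑[ b' < n ] ∑[ a < n ] ∑[ a' < n ] ∑[ x₁ < n ] ∑[ x₂ < n ] oct x₁ x₂ b b' a a'
          ≡⟨ ∑-comm₄ (λ x₁ b b' a a' → ∑[ x₂ < n ] oct x₁ x₂ b b' a a') ⟨
        ∑[ x₁ < n ] ∑[ b < n ] ∑[ b' < n ] ∑[ a < n ] ∑[ a' < n ] ∑[ x₂ < n ] oct x₁ x₂ b b' a a'
          ≡⟨ sum-cong-≗ (λ x₁ → ∑-comm₄ (λ x₂ b b' a a' → oct x₁ x₂ b b' a a')) ⟨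
        ∑[ x₁ < n ] ∑[ x₂ < n ] ∑[ b < n ] ∑[ b' < n ] ∑[ a < n ] ∑[ a' < n ] oct x₁ x₂ b b' a a'
          ≡⟨ #octahedra≡ ⟨
        #octahedra op ∎
        where
        open ≤-Reasoning
        oct : (x₁ x₂ b b' a a' : Fin n) → ℕ
        oct x₁ x₂ b b' a a' = ∑[ y₃ < n ] ∑[ y₄ < n ] [oct] x₁ x₂ b b' a a' y₃ y₄

      #assocTriples⁴-≤-n⁷*#octahedra : (#assocTriples op ²) ² ≤ n ^ 7 * #octahedra op
      #assocTriples⁴-≤-n⁷*#octahedra = begin
        (#assocTriples op ²) ²
          ≡⟨ cong (λ t → (t ²) ²) #assocTriples≡ ⟩
        ((∑[ g < n ] edges g) ²) ²
          ≤⟨ power-mean₄ n edges ⟩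
        n * n * n * ∑[ g < n ] ((edges g ²) ²)
          ≤⟨ *-monoʳ-≤ (n * n * n) (∑-mono-≤ λ g → rectangles-bound n n (w g)) ⟩
        n * n * n * ∑[ g < n ] (n * n * (n * n) * rectangles (w g))
          ≡⟨ cong (n * n * n *_) (*-distribˡ-sum (n * n * (n * n)) (λ g → rectangles (w g))) ⟨
        n * n * n * (n * n * (n * n) * ∑[ g < n ] rectangles (w g))
          ≤⟨ *-monoʳ-≤ (n * n * n) (*-monoʳ-≤ (n * n * (n * n)) ∑rectangles-≤-#octahedra) ⟩
        n * n * n * (n * n * (n * n) * #octahedra op)
          ≡⟨ n³*[n⁴*o]≡n⁷*o n (#octahedra op) ⟩
        n ^ 7 * #octahedra op ∎
        where
        open ≤-Reasoning
        w : Fin n → Fin n → Fin n → ℕ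
        w g a b = [assoc] a g b
        edges : Fin n → ℕ
        edges g = ∑[ a < n ] ∑[ b < n ] w g a b
        -- n ^ 7 written out as its unfolding, which the ring solver can normalise
        n³*[n⁴*o]≡n⁷*o : ∀ n o → n * n * n * (n * n * (n * n) * o) ≡ n * (n * (n * (n * (n * (n * (n * 1)))))) * o
        n³*[n⁴*o]≡n⁷*o = solve-∀

open import Data.Nat as ℕ using (ℕ; zero; suc; _^_)
import Data.Nat.Properties as ℕ
open import Data.Integer using (+_)
import Data.Integer as ℤ
import Data.Integer.Properties as ℤ
open import Data.Rational using (ℚ; _≤_; _*_; _/_; 0ℚ; mkℚ; *≤*; Positive; nonNegative)
open import Data.Rational.Properties
open import Data.Rational.Solver using (module +-*-Solver)
open import Data.Nat.Coprimality using (1-coprimeTo)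
import Data.Nat.Coprimality as Coprime
open import Data.Product using (_,_)
open import Relation.Binary.PropositionalEquality
open Counting using (_²; #assocTriples⁴-≤-n⁷*#octahedra)

ℕtoℚ≡mkℚ : ∀ m → ℕtoℚ m ≡ mkℚ (+ m) 0 (Coprime.sym (1-coprimeTo m))
ℕtoℚ≡mkℚ m = normalize-coprime (Coprime.sym (1-coprimeTo m))

ℕtoℚ-* : ∀ m n → ℕtoℚ (m ℕ.* n) ≡ ℕtoℚ m * ℕtoℚ n
ℕtoℚ-* m n = trans (cong (_/ 1) (ℤ.pos-* m n)) (sym (cong₂ _*_ (ℕtoℚ≡mkℚ m) (ℕtoℚ≡mkℚ n)))

ℕtoℚ-mono-≤ : ∀ {m n} → m ℕ.≤ n → ℕtoℚ m ≤ ℕtoℚ n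
ℕtoℚ-mono-≤ {m} {n} m≤n = subst₂ _≤_ (sym (ℕtoℚ≡mkℚ m)) (sym (ℕtoℚ≡mkℚ n))
  (*≤* (subst₂ ℤ._≤_ (sym (ℤ.*-identityʳ (+ m))) (sym (ℤ.*-identityʳ (+ n))) (ℤ.+≤+ m≤n)))

ℕtoℚ-nonNeg : ∀ m → 0ℚ ≤ ℕtoℚ m
ℕtoℚ-nonNeg m = ℕtoℚ-mono-≤ {0} {m} ℕ.z≤n

ℕtoℚ-⁴ : ∀ m → ℕtoℚ ((m ²) ²) ≡ (ℕtoℚ m * ℕtoℚ m) * (ℕtoℚ m * ℕtoℚ m)
ℕtoℚ-⁴ m = trans (ℕtoℚ-* (m ²) (m ²)) (cong₂ _*_ (ℕtoℚ-* m m) (ℕtoℚ-* m m))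

square-mono-≤ : ∀ {p q} → 0ℚ ≤ p → p ≤ q → p * p ≤ q * q
square-mono-≤ {p} {q} 0≤p p≤q = ≤-trans (*-monoˡ-≤-nonNeg p {{nonNegative 0≤p}} p≤q)
                                        (*-monoʳ-≤-nonNeg q {{nonNegative (≤-trans 0≤p p≤q)}} p≤q)

n⁵*n⁷≡[n³]⁴ : ∀ n → n ^ 5 ℕ.* n ^ 7 ≡ ((n ^ 3) ²) ²
n⁵*n⁷≡[n³]⁴ n =
  trans (sym (ℕ.^-distribˡ-+-* n 5 7))
  (trans (ℕ.^-distribˡ-+-* n 6 6) (cong₂ ℕ._*_ (ℕ.^-distribˡ-+-* n 3 3) (ℕ.^-distribˡ-+-* n 3 3)))

quartic-rescaling : ∀ n t o (ε : ℚ) → 0ℚ ≤ ε →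
  ε * ℕtoℚ (n ^ 3) ≤ ℕtoℚ t → (t ²) ² ℕ.≤ n ^ 7 ℕ.* o →
  ε * ε * ε * ε * ℕtoℚ (n ^ 5) ≤ ℕtoℚ o
quartic-rescaling zero t o ε _ _ _ =
  subst (_≤ ℕtoℚ o) (sym (*-zeroʳ (ε * ε * ε * ε))) (ℕtoℚ-nonNeg o)
quartic-rescaling n@(suc _) t o ε 0≤ε εn³≤t t⁴≤n⁷o = *-cancelʳ-≤-pos n⁷ {{n⁷>0}} (begin
  ε * ε * ε * ε * ℕtoℚ (n ^ 5) * n⁷                ≡⟨ *-assoc (ε * ε * ε * ε) _ _ ⟩
  ε * ε * ε * ε * (ℕtoℚ (n ^ 5) * n⁷)              ≡⟨ cong (ε * ε * ε * ε *_) n⁵n⁷≡n³⁴ ⟩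
  ε * ε * ε * ε * ((n³ * n³) * (n³ * n³))          ≡⟨ regroup ε n³ ⟩
  ((ε * n³) * (ε * n³)) * ((ε * n³) * (ε * n³))    ≤⟨ square-mono-≤ (square-mono-≤ ≤-refl 0≤εn³) (square-mono-≤ 0≤εn³ εn³≤t) ⟩
  (ℕtoℚ t * ℕtoℚ t) * (ℕtoℚ t * ℕtoℚ t)            ≡⟨ ℕtoℚ-⁴ t ⟨
  ℕtoℚ ((t ²) ²)                                   ≤⟨ ℕtoℚ-mono-≤ t⁴≤n⁷o ⟩
  ℕtoℚ (n ^ 7 ℕ.* o)                               ≡⟨ trans (ℕtoℚ-* (n ^ 7) o) (*-comm n⁷ (ℕtoℚ o)) ⟩
  ℕtoℚ o * n⁷                                      ∎)
  where
  open ≤-Reasoning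
  n³ = ℕtoℚ (n ^ 3)
  n⁷ = ℕtoℚ (n ^ 7)
  n⁷>0 : Positive n⁷
  n⁷>0 = normalize-pos (n ^ 7) 1 {{_}} {{ℕ.m^n≢0 n 7}}
  0≤εn³ : 0ℚ ≤ ε * n³
  0≤εn³ = nonNegative⁻¹ (ε * n³)
    {{nonNeg*nonNeg⇒nonNeg ε {{nonNegative 0≤ε}} n³ {{nonNegative (ℕtoℚ-nonNeg (n ^ 3))}}}}
  n⁵n⁷≡n³⁴ : ℕtoℚ (n ^ 5) * n⁷ ≡ (n³ * n³) * (n³ * n³)
  n⁵n⁷≡n³⁴ = trans (sym (ℕtoℚ-* (n ^ 5) (n ^ 7))) (trans (cong ℕtoℚ (n⁵*n⁷≡[n³]⁴ n)) (ℕtoℚ-⁴ (n ^ 3)))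
  regroup : ∀ e c → e * e * e * e * ((c * c) * (c * c)) ≡ ((e * c) * (e * c)) * ((e * c) * (e * c))
  regroup = solve 2 (λ e c → e :* e :* e :* e :* ((c :* c) :* (c :* c))
                          := ((e :* c) :* (e :* c)) :* ((e :* c) :* (e :* c))) refl
    where open +-*-Solver

lemma1p8 : (n : ℕ) (op : PartialOp n) (ε : ℚ) →
    0ℚ ≤ ε →
    InjectiveInEachVariable op →
    ε * ℕtoℚ (n ^ 3) ≤ ℕtoℚ (#assocTriples op) →
    ε * ε * ε * ε * ℕtoℚ (n ^ 5) ≤ ℕtoℚ (#octahedra op)
lemma1p8 n op ε 0≤ε (injectiveʳ , _) εn³≤#assoc =
  quartic-rescaling n (#assocTriples op) (#octahedra op) ε 0≤ε εn³≤#assoc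
    (#assocTriples⁴-≤-n⁷*#octahedra op injectiveʳ)
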